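{- For $\epsilon\in\{0,1\}$, integers $N>M>0$, $r\ge1$ and $\boldsymbol X=(Y_1,X_1,\dots,Y_r,X_r)$, $$\frac{\langle N-M\rangle-\langle Y_1\rangle}{\langle N-M\rangle}G^\epsilon_{q,M-1,N}(\boldsymbol X)=\left(1+\frac{q^M\langle Y_1\rangle}{\langle M\rangle}\right)^{\epsilon}G^\epsilon_{q,M,N}(\boldsymbol X)+\frac{q^M}{\langle M\rangle^\epsilon}\,\frac{1}{\langle M\rangle-\langle X_1\rangle}\,G^\epsilon_{q,M,N}(Y_2,X_2,\dots,Y_r,X_r).$$
   Context: For an integer $n$, $\langle n\rangle:=1-q^n$. The symbols $\langle X_i\rangle,\langle Y_i\rangle$ are independent formal variables (standing for $1-q^{X_i}$, $1-q^{Y_i}$); identities are between formal power series in these variables with coefficients in $\mathbb Q((q))$, where the displayed denominators are invertible. Let $\bar1$ be a formal symbol. For integers $N>M\ge0$ and $\boldsymbol k=(k_1,\dots,k_r)$ with entries in $\{\bar1\}\cup\mathbb Z_{\ge1}$, $k_r\ne\bar1$: $$\zeta_{q,M,N}^\dagger(\boldsymbol k)=\sum_{\substack{M<n_1\le\cdots\le n_r<N\\ n_i<n_{i+1}\text{ whenever }k_i\ne\bar1}}\Bigg(\prod_{j:\,k_j=\bar1}\frac{1}{\langle N-n_j\rangle}\Bigg)\Bigg(\prod_{j:\,k_j\ne\bar1}\frac{q^{n_j}}{\langle n_j\rangle^{k_j}}\Bigg),$$ and for $\boldsymbol k\in\mathbb Z_{\ge1}^r$ with $k_r\ge2$: $$\zeta_{q,M,N}^{\diamondsuit,\dagger}(\boldsymbol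 k)=\sum_{A\subset\{i:k_i=1\}}\ \sum_{\substack{M<n_1\le\cdots\le n_r<N\\ n_i<n_{i+1}\ (i\notin A)}}\Bigg(\prod_{i\in A}\frac{1}{\langle N-n_i\rangle}\Bigg)\Bigg(\prod_{i\notin A}\frac{q^{n_i}}{\langle n_i\rangle^{k_i}}\Bigg)$$ (empty tuple gives $1$). For $l_j,k_j\ge1$ put $\xi^0_{q,M,N}(l_1,k_1,\dots,l_r,k_r)=\zeta^\dagger_{q,M,N}(\{\bar1\}^{l_1-1},k_1,\dots,\{\bar1\}^{l_r-1},k_r)$ and $\xi^1_{q,M,N}(l_1,k_1,\dots,l_r,k_r)=\zeta^{\diamondsuit,\dagger}_{q,M,N}(\{1\}^{l_1-1},k_1+1,\dots,\{1\}^{l_r-1},k_r+1)$, where $\{a\}^m$ means $m$ repetitions of $a$. Define $$G^\epsilon_{q,M,N}(Y_1,X_1,\dots,Y_r,X_r)=\sum_{k_1,\dots,k_r,l_1,\dots,l_r\ge0}\Bigg(\prod_{j=1}^r\langle Y_j\rangle^{l_j}\langle X_j\rangle^{k_j}\Bigg)\xi^\epsilon_{q,M,N}(l_1+1,k_1+1,\dots,l_r+1,k_r+1),$$ with $G^\epsilon_{q,M,N}()=1$ for $r=0$. -}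

module Defs where

open import Data.Nat as ℕ using (ℕ; zero; suc; _∸_; _≡ᵇ_)
open import Data.Bool using (Bool; true; false; _∧_; if_then_else_)
open import Data.Rational as ℚ using (ℚ; 0ℚ; 1ℚ)
open import Data.Product using (_×_; _,_)
open import Data.Vec as Vec using (Vec; []; _∷_)
open import Data.List as List using (List; []; _∷_; _++_; replicate; concatMap)
open import Data.Fin as Fin using (Fin; toℕ)
open import Relation.Binary.PropositionalEquality using (_≡_)

-- Formal power series in q with rational coefficients, Q[[q]] ⊂ Q((q)).
-- A series is its coefficient function; coefficient j is that of q^j.

PS : Set
PS = ℕ → ℚ

sumLt : ℕ → (ℕ → ℚ) → ℚ
sumLt zero    f = 0ℚ
sumLt (suc n) f = sumLt n f ℚ.+ f n

zeroP : PS
zeroP _ = 0ℚ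

oneP : PS
oneP zero    = 1ℚ
oneP (suc _) = 0ℚ

infixl 6 _+P_ _-P_
infixl 7 _*P_

_+P_ : PS → PS → PS
(f +P g) j = f j ℚ.+ g j

_-P_ : PS → PS → PS
(f -P g) j = f j ℚ.- g j

_*P_ : PS → PS → PS
(f *P g) n = sumLt (suc n) (λ i → f i ℚ.* g (n ∸ i))

sumLtP : ℕ → (ℕ → PS) → PS
sumLtP n F j = sumLt n (λ i → F i j)

powP : PS → ℕ → PS
powP f zero    = oneP
powP f (suc k) = powP f k *P f

qpow : ℕ → PS
qpow n j = if j ≡ᵇ n then 1ℚ else 0ℚ

bracket : ℕ → PS
bracket n = oneP -P qpow n

-- inverse of a series a with constant term 1:  a⁻¹ = Σ_k (1 - a)^k
-- (the coefficient of q^j only receives contributions from k ≤ j).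
invOne : PS → PS
invOne a j = sumLt (suc j) (λ k → powP (oneP -P a) k j)

-- Formal power series over Q[[q]] in the variables
-- ⟨Y_1⟩,⟨X_1⟩,…,⟨Y_r⟩,⟨X_r⟩.  A multi-index is a vector of pairs
-- (exponent of ⟨Y_j⟩, exponent of ⟨X_j⟩).

Idx : ℕ → Set
Idx r = Vec (ℕ × ℕ) r

MPS : ℕ → Set
MPS r = Idx r → PS

infix 4 _≈M_
_≈M_ : ∀ {r} → MPS r → MPS r → Set
f ≈M g = ∀ α j → f α j ≡ g α j

isZeroIdx : ∀ {r} → Idx r → Bool
isZeroIdx []            = true
isZeroIdx ((a , b) ∷ α) = (a ≡ᵇ 0) ∧ (b ≡ᵇ 0) ∧ isZeroIdx α

totDeg : ∀ {r} → Idx r → ℕ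
totDeg []            = 0
totDeg ((a , b) ∷ α) = a ℕ.+ b ℕ.+ totDeg α

sumSub : ∀ {r} → Idx r → (Idx r → Idx r → PS) → PS
sumSub []            h = h [] []
sumSub ((a , b) ∷ α) h =
  sumLtP (suc a) (λ i → sumLtP (suc b) (λ k →
    sumSub α (λ β γ → h ((i , k) ∷ β) ((a ∸ i , b ∸ k) ∷ γ))))

infixl 6 _+M_ _-M_
infixl 7 _*M_

_+M_ : ∀ {r} → MPS r → MPS r → MPS r
(f +M g) α = f α +P g α

_-M_ : ∀ {r} → MPS r → MPS r → MPS r
(f -M g) α = f α -P g α

_*M_ : ∀ {r} → MPS r → MPS r → MPS r
(f *M g) α = sumSub α (λ β γ → f β *P g γ)

constM : ∀ {r} → PS → MPS r
constM c α = if isZeroIdx α then c else zeroP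

oneM : ∀ {r} → MPS r
oneM = constM oneP

powM : ∀ {r} → MPS r → ℕ → MPS r
powM f zero    = oneM
powM f (suc k) = powM f k *M f

varY1 : ∀ {s} → MPS (suc s)
varY1 ((a , b) ∷ α) = if (a ≡ᵇ 1) ∧ (b ≡ᵇ 0) ∧ isZeroIdx α then oneP else zeroP

varX1 : ∀ {s} → MPS (suc s)
varX1 ((a , b) ∷ α) = if (a ≡ᵇ 0) ∧ (b ≡ᵇ 1) ∧ isZeroIdx α then oneP else zeroP

-- inverse of a series f whose constant coefficient has constant term 1:
-- f⁻¹ = Σ_k (1 - f)^k; (1 - f)^k has no terms of total degree
-- (in q and the variables) below k, so the sum is finite coefficientwise.
invM : ∀ {r} → MPS r → MPS r
invM f α j = sumLt (suc (totDeg α ℕ.+ j)) (λ k → powM (oneM -M f) k α j)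

embed : ∀ {s} → MPS s → MPS (suc s)
embed f ((a , b) ∷ α) = if (a ≡ᵇ 0) ∧ (b ≡ᵇ 0) then f α else zeroP

-- an entry of an index: the formal symbol 1̄ or a positive integer
data Ent : Set where
  bar : Ent
  nat : ℕ → Ent

term : ℕ → Ent → ℕ → PS
term N bar     n = invOne (bracket (N ∸ n))
term N (nat k) n = qpow n *P powP (invOne (bracket n)) k

next : Ent → ℕ → ℕ
next bar     n = n
next (nat _) n = suc n

-- sum over lo ≤ n_1 ≤ … ≤ n_r < N, strict after non-1̄ entries
Zsum : ℕ → ℕ → List Ent → PS
Zsum N lo []       = oneP
Zsum N lo (e ∷ es) =
  sumLtP (N ∸ lo) (λ i → term N e (lo ℕ.+ i) *P Zsum N (next e (lo ℕ.+ i)) es)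

zetaDag : ℕ → ℕ → List Ent → PS
zetaDag M N ks = Zsum N (suc M) ks

-- all indices obtained from k by replacing the entries 1 in a subset A of
-- {i : k_i = 1} by 1̄ (one list per subset A)
variants : List ℕ → List (List Ent)
variants []       = [] ∷ []
variants (k ∷ ks) = concatMap (opt k) (variants ks)
  where
  opt : ℕ → List Ent → List (List Ent)
  opt (suc zero) v = (bar ∷ v) ∷ (nat 1 ∷ v) ∷ []
  opt k          v = (nat k ∷ v) ∷ []

sumPSList : List PS → PS
sumPSList []       = zeroP
sumPSList (f ∷ fs) = f +P sumPSList fs

zetaDiaDag : ℕ → ℕ → List ℕ → PS
zetaDiaDag M N ks = sumPSList (List.map (zetaDag M N) (variants ks))

xi0 : ℕ → ℕ → List (ℕ × ℕ) → PS
xi0 M N ps = zetaDag M N (concatMap (λ { (l , k) → replicate (l ∸ 1) bar ++ nat k ∷ [] }) ps)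

xi1 : ℕ → ℕ → List (ℕ × ℕ) → PS
xi1 M N ps = zetaDiaDag M N (concatMap (λ { (l , k) → replicate (l ∸ 1) 1 ++ suc k ∷ [] }) ps)

xi : Fin 2 → ℕ → ℕ → List (ℕ × ℕ) → PS
xi Fin.zero       = xi0
xi (Fin.suc _)    = xi1

-- G^ε_{q,M,N}(Y_1,X_1,…,Y_r,X_r): coefficient of Π ⟨Y_j⟩^{l_j}⟨X_j⟩^{k_j}
-- is ξ^ε(l_1+1,k_1+1,…,l_r+1,k_r+1)
G : ∀ {r} → Fin 2 → ℕ → ℕ → MPS r
G ε M N α = xi ε M N (Vec.toList (Vec.map (λ { (l , k) → (suc l , suc k) }) α))

-- Splitting off the smallest summation index n₁ = M of ξ^ε_{q,M-1,N} and comparing coefficients of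
-- ⟨Y₁⟩^l ⟨X₁⟩^k: for l > 0 the first entry is 1̄ (for ε = 1 also 1), and the term n₁ = M contributes
-- ⟨N-M⟩⁻¹ times the coefficient of ⟨Y₁⟩^(l-1) in G_{M-1,N} (for ε = 1 also q^M⟨M⟩⁻¹ times that of G_{M,N});
-- for l = 0 the first entry is k+1+ε and contributes q^M ⟨M⟩^-(k+1+ε) G_{M,N}(Y₂,X₂,…). Multiplying by
-- 1 - ⟨Y₁⟩/⟨N-M⟩ removes the first kind of term, and the second kind is exactly the ⟨X₁⟩^k coefficient of
-- q^M⟨M⟩^-ε (⟨M⟩ - ⟨X₁⟩)⁻¹ G_{M,N}(Y₂,X₂,…), since the defining geometric series of that inverse satisfies
-- I = ⟨M⟩⁻¹ (1 + ⟨X₁⟩ I), i.e. I = Σ_k ⟨X₁⟩^k ⟨M⟩^-(k+1).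

module Submission where

open import Defs
open import Data.Bool using (true; false)
open import Data.Empty using (⊥-elim)
open import Data.Fin as Fin using (Fin; toℕ; #_)
open import Data.List as List using (List; []; _∷_; _++_; concatMap)
import Data.List.Properties as Listₚ
open import Data.Nat as ℕ using (ℕ; zero; suc; _∸_; _≤_; _<_; z≤n; s≤s)
import Data.Nat.Properties as ℕₚ
open import Data.Product using (_,_; proj₁; proj₂)
open import Data.Rational using (ℚ; 0ℚ; 1ℚ; _+_; _*_; _-_)
import Data.Rational.Properties as ℚₚ
open import Data.Rational.Solver using (module +-*-Solver)
open import Data.Vec as Vec using ([]; _∷_)
open import Function using (_∘_)
open import Relation.Binary.Bundles using (Setoid)
open import Relation.Binary.PropositionalEquality
import Relation.Binary.Reasoning.Setoid as SetoidReasoning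
open import Relation.Nullary using (yes; no)

open +-*-Solver using (solve; _:+_; _:*_; _:-_; _:=_; con)

-- Finite sums of rationals

sumLt-cong-< : ∀ n {f g : ℕ → ℚ} → (∀ i → i < n → f i ≡ g i) → sumLt n f ≡ sumLt n g
sumLt-cong-< zero    f≡g = refl
sumLt-cong-< (suc n) f≡g =
  cong₂ _+_ (sumLt-cong-< n (λ i i<n → f≡g i (ℕₚ.m<n⇒m<1+n i<n))) (f≡g n ℕₚ.≤-refl)

sumLt-cong : ∀ n {f g : ℕ → ℚ} → f ≗ g → sumLt n f ≡ sumLt n g
sumLt-cong n f≗g = sumLt-cong-< n (λ i _ → f≗g i)

sumLt-zero : ∀ n {f : ℕ → ℚ} → (∀ i → i < n → f i ≡ 0ℚ) → sumLt n f ≡ 0ℚ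
sumLt-zero n {f} f≡0 = trans (sumLt-cong-< n f≡0) (zeros n)
  where
  zeros : ∀ n → sumLt n (λ _ → 0ℚ) ≡ 0ℚ
  zeros zero    = refl
  zeros (suc n) = cong (_+ 0ℚ) (zeros n)

sumLt-distrib-+ : ∀ n (f g : ℕ → ℚ) → sumLt n (λ i → f i + g i) ≡ sumLt n f + sumLt n g
sumLt-distrib-+ zero    f g = refl
sumLt-distrib-+ (suc n) f g = begin
  sumLt n (λ i → f i + g i) + (f n + g n) ≡⟨ cong (_+ (f n + g n)) (sumLt-distrib-+ n f g) ⟩
  (sumLt n f + sumLt n g) + (f n + g n)
    ≡⟨ solve 4 (λ a b c d → (a :+ b) :+ (c :+ d) := (a :+ c) :+ (b :+ d))
                                                refl (sumLt n f) (sumLt n g) (f n) (g n) ⟩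
  (sumLt n f + f n) + (sumLt n g + g n) ∎
  where open ≡-Reasoning

sumLt-distrib-minus : ∀ n (f g : ℕ → ℚ) → sumLt n (λ i → f i - g i) ≡ sumLt n f - sumLt n g
sumLt-distrib-minus zero    f g = refl
sumLt-distrib-minus (suc n) f g = begin
  sumLt n (λ i → f i - g i) + (f n - g n) ≡⟨ cong (_+ (f n - g n)) (sumLt-distrib-minus n f g) ⟩
  (sumLt n f - sumLt n g) + (f n - g n)
    ≡⟨ solve 4 (λ a b c d → (a :- b) :+ (c :- d) := (a :+ c) :- (b :+ d))
                                                refl (sumLt n f) (sumLt n g) (f n) (g n) ⟩
  (sumLt n f + f n) - (sumLt n g + g n) ∎
  where open ≡-Reasoning

*-distribˡ-sumLt : ∀ n c (f : ℕ → ℚ) → c * sumLt n f ≡ sumLt n (λ i → c * f i)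
*-distribˡ-sumLt zero    c f = ℚₚ.*-zeroʳ c
*-distribˡ-sumLt (suc n) c f =
  trans (ℚₚ.*-distribˡ-+ c (sumLt n f) (f n)) (cong (_+ c * f n) (*-distribˡ-sumLt n c f))

*-distribʳ-sumLt : ∀ n c (f : ℕ → ℚ) → sumLt n f * c ≡ sumLt n (λ i → f i * c)
*-distribʳ-sumLt n c f = begin
  sumLt n f * c              ≡⟨ ℚₚ.*-comm (sumLt n f) c ⟩
  c * sumLt n f              ≡⟨ *-distribˡ-sumLt n c f ⟩
  sumLt n (λ i → c * f i)    ≡⟨ sumLt-cong n (λ i → ℚₚ.*-comm c (f i)) ⟩
  sumLt n (λ i → f i * c)    ∎
  where open ≡-Reasoning

sumLt-head : ∀ n (f : ℕ → ℚ) → sumLt (suc n) f ≡ f 0 + sumLt n (λ i → f (suc i))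
sumLt-head zero    f = trans (ℚₚ.+-identityˡ (f 0)) (sym (ℚₚ.+-identityʳ (f 0)))
sumLt-head (suc n) f =
  trans (cong (_+ f (suc n)) (sumLt-head n f)) (ℚₚ.+-assoc (f 0) _ (f (suc n)))

sumLt-single : ∀ n i₀ {f : ℕ → ℚ} → i₀ < n → (∀ i → i < n → i ≢ i₀ → f i ≡ 0ℚ) →
               sumLt n f ≡ f i₀
sumLt-single (suc n) i₀ {f} i₀<1+n f≡0 with i₀ ℕ.≟ n
... | yes refl = trans (cong (_+ f n) rest≡0) (ℚₚ.+-identityˡ (f n))
  where
  rest≡0 : sumLt n f ≡ 0ℚ
  rest≡0 = sumLt-zero n (λ i i<n → f≡0 i (ℕₚ.m<n⇒m<1+n i<n) (ℕₚ.<⇒≢ i<n))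
... | no i₀≢n =
  trans (cong₂ _+_ rest≡fi₀ (f≡0 n ℕₚ.≤-refl (i₀≢n ∘ sym))) (ℚₚ.+-identityʳ (f i₀))
  where
  rest≡fi₀ : sumLt n f ≡ f i₀
  rest≡fi₀ = sumLt-single n i₀ (ℕₚ.≤∧≢⇒< (ℕₚ.≤-pred i₀<1+n) i₀≢n)
                          (λ i i<n → f≡0 i (ℕₚ.m<n⇒m<1+n i<n))

sumLt-reverse : ∀ n (f : ℕ → ℚ) → sumLt (suc n) f ≡ sumLt (suc n) (λ i → f (n ∸ i))
sumLt-reverse zero    f = refl
sumLt-reverse (suc n) f = begin
  sumLt (suc n) f + f (suc n)                   ≡⟨ cong (_+ f (suc n)) (sumLt-reverse n f) ⟩
  sumLt (suc n) (λ i → f (n ∸ i)) + f (suc n)   ≡⟨ ℚₚ.+-comm _ (f (suc n)) ⟩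
  f (suc n) + sumLt (suc n) (λ i → f (n ∸ i))   ≡⟨ sumLt-head (suc n) (λ i → f (suc n ∸ i)) ⟨
  sumLt (suc (suc n)) (λ i → f (suc n ∸ i))     ∎
  where open ≡-Reasoning

sumLt-reflect : ∀ n (F : ℕ → ℕ → ℚ) →
  sumLt (suc n) (λ i → F i (n ∸ i)) ≡ sumLt (suc n) (λ i → F (n ∸ i) i)
sumLt-reflect n F = trans (sumLt-reverse n (λ i → F i (n ∸ i)))
  (sumLt-cong-< (suc n) (λ i i<1+n → cong (F (n ∸ i)) (ℕₚ.m∸[m∸n]≡n (ℕₚ.≤-pred i<1+n))))

sumLt-comm : ∀ n m (F : ℕ → ℕ → ℚ) →
             sumLt n (λ i → sumLt m (F i)) ≡ sumLt m (λ k → sumLt n (λ i → F i k))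
sumLt-comm zero    m F = sym (sumLt-zero m (λ _ _ → refl))
sumLt-comm (suc n) m F = begin
  sumLt n (λ i → sumLt m (F i)) + sumLt m (F n)
    ≡⟨ cong (_+ sumLt m (F n)) (sumLt-comm n m F) ⟩
  sumLt m (λ k → sumLt n (λ i → F i k)) + sumLt m (F n)
    ≡⟨ sumLt-distrib-+ m (λ k → sumLt n (λ i → F i k)) (F n) ⟨
  sumLt m (λ k → sumLt (suc n) (λ i → F i k)) ∎
  where open ≡-Reasoning

sumLt-triangle : ∀ n (H : ℕ → ℕ → ℚ) →
  sumLt (suc n) (λ i → sumLt (suc i) (λ a → H a i)) ≡
  sumLt (suc n) (λ a → sumLt (suc (n ∸ a)) (λ b → H a (a ℕ.+ b)))
sumLt-triangle zero    H = refl
sumLt-triangle (suc n) H = begin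
  sumLt (suc (suc n)) (λ i → sumLt (suc i) (λ a → H a i))
    ≡⟨ sumLt-cong (suc (suc n)) (λ i → sumLt-head i (λ a → H a i)) ⟩
  sumLt (suc (suc n)) (λ i → H 0 i + sumLt i (λ a → H (suc a) i))
    ≡⟨ sumLt-distrib-+ (suc (suc n)) (H 0) (λ i → sumLt i (λ a → H (suc a) i)) ⟩
  row₀ + sumLt (suc (suc n)) (λ i → sumLt i (λ a → H (suc a) i))
    ≡⟨ cong (row₀ +_) (trans (sumLt-head (suc n) (λ i → sumLt i (λ a → H (suc a) i)))
                             (ℚₚ.+-identityˡ _)) ⟩
  row₀ + sumLt (suc n) (λ i → sumLt (suc i) (λ a → H (suc a) (suc i)))
    ≡⟨ cong (row₀ +_) (sumLt-triangle n (λ a i → H (suc a) (suc i))) ⟩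
  row₀ + sumLt (suc n) (λ a → sumLt (suc (n ∸ a)) (λ b → H (suc a) (suc (a ℕ.+ b))))
    ≡⟨ sumLt-head (suc n) (λ a → sumLt (suc (suc n ∸ a)) (λ b → H a (a ℕ.+ b))) ⟨
  sumLt (suc (suc n)) (λ a → sumLt (suc (suc n ∸ a)) (λ b → H a (a ℕ.+ b)))
    ∎
  where
  open ≡-Reasoning
  row₀ : ℚ
  row₀ = sumLt (suc (suc n)) (H 0)

sumLt-vanishing-tail : ∀ m n {f : ℕ → ℚ} → m ≤ n → (∀ i → m ≤ i → i < n → f i ≡ 0ℚ) →
                       sumLt n f ≡ sumLt m f
sumLt-vanishing-tail m zero    z≤n f≡0 = refl
sumLt-vanishing-tail m (suc n) {f} m≤1+n f≡0 with m ℕ.≟ suc n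
... | yes refl = refl
... | no m≢1+n =
  trans (cong₂ _+_ (sumLt-vanishing-tail m n m≤n (λ i m≤i i<n → f≡0 i m≤i (ℕₚ.m<n⇒m<1+n i<n)))
                   (f≡0 n m≤n ℕₚ.≤-refl))
        (ℚₚ.+-identityʳ (sumLt m f))
  where
  m≤n : m ≤ n
  m≤n = ℕₚ.≤-pred (ℕₚ.≤∧≢⇒< m≤1+n m≢1+n)

sumLt-telescope : ∀ n (F : ℕ → ℚ) → sumLt n (λ k → F k - F (suc k)) ≡ F 0 - F n
sumLt-telescope zero    F = sym (ℚₚ.+-inverseʳ (F 0))
sumLt-telescope (suc n) F =
  trans (cong (_+ (F n - F (suc n))) (sumLt-telescope n F))
        (solve 3 (λ a b c → (a :- b) :+ (b :- c) := a :- c) refl (F 0) (F n) (F (suc n)))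

-- Power series in q

module ≗-Reasoning = SetoidReasoning (ℕ →-setoid ℚ)
open Setoid (ℕ →-setoid ℚ) using () renaming (refl to ≗-refl; sym to ≗-sym; trans to ≗-trans)

+P-cong : ∀ {f f′ g g′} → f ≗ f′ → g ≗ g′ → f +P g ≗ f′ +P g′
+P-cong f≗f′ g≗g′ j = cong₂ _+_ (f≗f′ j) (g≗g′ j)

+P-identityˡ : ∀ f → zeroP +P f ≗ f
+P-identityˡ f j = ℚₚ.+-identityˡ (f j)

+P-identityʳ : ∀ f → f +P zeroP ≗ f
+P-identityʳ f j = ℚₚ.+-identityʳ (f j)

-P-cong : ∀ {f f′ g g′} → f ≗ f′ → g ≗ g′ → f -P g ≗ f′ -P g′
-P-cong f≗f′ g≗g′ j = cong₂ _-_ (f≗f′ j) (g≗g′ j)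

*P-cong : ∀ {f f′ g g′} → f ≗ f′ → g ≗ g′ → f *P g ≗ f′ *P g′
*P-cong f≗f′ g≗g′ n = sumLt-cong (suc n) (λ i → cong₂ _*_ (f≗f′ i) (g≗g′ (n ∸ i)))

*P-congˡ : ∀ f {g g′} → g ≗ g′ → f *P g ≗ f *P g′
*P-congˡ f = *P-cong {f} (λ _ → refl)

*P-congʳ : ∀ g {f f′} → f ≗ f′ → f *P g ≗ f′ *P g
*P-congʳ g f≗f′ = *P-cong {g = g} f≗f′ (λ _ → refl)

*P-cong-≤ : ∀ j {f f′ g g′} → (∀ i → i ≤ j → f i ≡ f′ i) → (∀ i → i ≤ j → g i ≡ g′ i) →
            (f *P g) j ≡ (f′ *P g′) j
*P-cong-≤ j f≡f′ g≡g′ = sumLt-cong-< (suc j)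
  (λ i i≤j → cong₂ _*_ (f≡f′ i (ℕₚ.≤-pred i≤j)) (g≡g′ (j ∸ i) (ℕₚ.m∸n≤m j i)))

*P-comm : ∀ f g → f *P g ≗ g *P f
*P-comm f g n = trans (sumLt-reflect n (λ i i′ → f i * g i′))
                      (sumLt-cong (suc n) (λ i → ℚₚ.*-comm (f (n ∸ i)) (g i)))

*P-assoc : ∀ f g h → (f *P g) *P h ≗ f *P (g *P h)
*P-assoc f g h n = begin
  sumLt (suc n) (λ i → sumLt (suc i) (λ a → f a * g (i ∸ a)) * h (n ∸ i))
    ≡⟨ sumLt-cong (suc n) (λ i → *-distribʳ-sumLt (suc i) (h (n ∸ i)) (λ a → f a * g (i ∸ a))) ⟩
  sumLt (suc n) (λ i → sumLt (suc i) (λ a → f a * g (i ∸ a) * h (n ∸ i)))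
    ≡⟨ sumLt-triangle n (λ a i → f a * g (i ∸ a) * h (n ∸ i)) ⟩
  sumLt (suc n) (λ a → sumLt (suc (n ∸ a)) (λ b → f a * g (a ℕ.+ b ∸ a) * h (n ∸ (a ℕ.+ b))))
    ≡⟨ sumLt-cong (suc n) (λ a → sumLt-cong (suc (n ∸ a)) (reassociate a)) ⟩
  sumLt (suc n) (λ a → sumLt (suc (n ∸ a)) (λ b → f a * (g b * h (n ∸ a ∸ b))))
    ≡⟨ sumLt-cong (suc n) (λ a → *-distribˡ-sumLt (suc (n ∸ a)) (f a) (λ b → g b * h (n ∸ a ∸ b))) ⟨
  sumLt (suc n) (λ a → f a * sumLt (suc (n ∸ a)) (λ b → g b * h (n ∸ a ∸ b)))
    ∎
  where
  open ≡-Reasoning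
  reassociate : ∀ a b → f a * g (a ℕ.+ b ∸ a) * h (n ∸ (a ℕ.+ b)) ≡ f a * (g b * h (n ∸ a ∸ b))
  reassociate a b =
    trans (cong₂ (λ x y → f a * g x * h y) (ℕₚ.m+n∸m≡n a b) (sym (ℕₚ.∸-+-assoc n a b)))
          (ℚₚ.*-assoc (f a) (g b) (h (n ∸ a ∸ b)))

*P-distribˡ-+P : ∀ f g h → f *P (g +P h) ≗ f *P g +P f *P h
*P-distribˡ-+P f g h n =
  trans (sumLt-cong (suc n) (λ i → ℚₚ.*-distribˡ-+ (f i) (g (n ∸ i)) (h (n ∸ i))))
        (sumLt-distrib-+ (suc n) (λ i → f i * g (n ∸ i)) (λ i → f i * h (n ∸ i)))

*P-distribˡ-minus : ∀ f g h → f *P (g -P h) ≗ f *P g -P f *P h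
*P-distribˡ-minus f g h n =
  trans (sumLt-cong (suc n) (λ i → solve 3 (λ a b c → a :* (b :- c) := a :* b :- a :* c)
                                           refl (f i) (g (n ∸ i)) (h (n ∸ i))))
        (sumLt-distrib-minus (suc n) (λ i → f i * g (n ∸ i)) (λ i → f i * h (n ∸ i)))

*P-distribʳ-+P : ∀ h f g → (f +P g) *P h ≗ f *P h +P g *P h
*P-distribʳ-+P h f g = begin
  (f +P g) *P h       ≈⟨ *P-comm (f +P g) h ⟩
  h *P (f +P g)       ≈⟨ *P-distribˡ-+P h f g ⟩
  h *P f +P h *P g    ≈⟨ +P-cong (*P-comm h f) (*P-comm h g) ⟩
  f *P h +P g *P h    ∎
  where open ≗-Reasoning

*P-distribʳ-minus : ∀ h f g → (f -P g) *P h ≗ f *P h -P g *P h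
*P-distribʳ-minus h f g = begin
  (f -P g) *P h       ≈⟨ *P-comm (f -P g) h ⟩
  h *P (f -P g)       ≈⟨ *P-distribˡ-minus h f g ⟩
  h *P f -P h *P g    ≈⟨ -P-cong (*P-comm h f) (*P-comm h g) ⟩
  f *P h -P g *P h    ∎
  where open ≗-Reasoning

*P-identityˡ : ∀ f → oneP *P f ≗ f
*P-identityˡ f n = begin
  sumLt (suc n) (λ i → oneP i * f (n ∸ i))          ≡⟨ sumLt-head n (λ i → oneP i * f (n ∸ i)) ⟩
  1ℚ * f n + sumLt n (λ i → 0ℚ * f (n ∸ suc i))     ≡⟨ cong₂ _+_ (ℚₚ.*-identityˡ (f n))
                                                         (sumLt-zero n (λ i _ → ℚₚ.*-zeroˡ (f (n ∸ suc i)))) ⟩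
  f n + 0ℚ                                          ≡⟨ ℚₚ.+-identityʳ (f n) ⟩
  f n                                               ∎
  where open ≡-Reasoning

*P-identityʳ : ∀ f → f *P oneP ≗ f
*P-identityʳ f n = trans (*P-comm f oneP n) (*P-identityˡ f n)

*P-zeroˡ : ∀ f → zeroP *P f ≗ zeroP
*P-zeroˡ f n = sumLt-zero (suc n) (λ i _ → ℚₚ.*-zeroˡ (f (n ∸ i)))

*P-zeroʳ : ∀ f → f *P zeroP ≗ zeroP
*P-zeroʳ f n = sumLt-zero (suc n) (λ i _ → ℚₚ.*-zeroʳ (f i))

zero-*P : ∀ {f} g → f ≗ zeroP → f *P g ≗ zeroP
zero-*P g f≗0 = ≗-trans (*P-congʳ g f≗0) (*P-zeroˡ g)

*P-distribˡ-sumLtP : ∀ K f (F : ℕ → PS) → f *P sumLtP K F ≗ sumLtP K (λ k → f *P F k)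
*P-distribˡ-sumLtP K f F n = begin
  sumLt (suc n) (λ i → f i * sumLt K (λ k → F k (n ∸ i)))
    ≡⟨ sumLt-cong (suc n) (λ i → *-distribˡ-sumLt K (f i) (λ k → F k (n ∸ i))) ⟩
  sumLt (suc n) (λ i → sumLt K (λ k → f i * F k (n ∸ i)))
    ≡⟨ sumLt-comm (suc n) K (λ i k → f i * F k (n ∸ i)) ⟩
  sumLt K (λ k → sumLt (suc n) (λ i → f i * F k (n ∸ i))) ∎
  where open ≡-Reasoning

powP-+ : ∀ f a b → powP f a *P powP f b ≗ powP f (a ℕ.+ b)
powP-+ f zero    b = *P-identityˡ (powP f b)
powP-+ f (suc a) b = begin
  (powP f a *P f) *P powP f b     ≈⟨ *P-assoc (powP f a) f (powP f b) ⟩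
  powP f a *P (f *P powP f b)     ≈⟨ *P-congˡ (powP f a) (*P-comm f (powP f b)) ⟩
  powP f a *P (powP f b *P f)     ≈⟨ *P-assoc (powP f a) (powP f b) f ⟨
  (powP f a *P powP f b) *P f     ≈⟨ *P-congʳ f (powP-+ f a b) ⟩
  powP f (a ℕ.+ b) *P f           ∎
  where open ≗-Reasoning

*P-vanishes : ∀ c F j → c 0 ≡ 0ℚ → (∀ i → i < j → F i ≡ 0ℚ) → (c *P F) j ≡ 0ℚ
*P-vanishes c F j c₀≡0 F≡0 = sumLt-zero (suc j) vanish
  where
  vanish : ∀ i → i < suc j → c i * F (j ∸ i) ≡ 0ℚ
  vanish zero _ = trans (cong (_* F j) c₀≡0) (ℚₚ.*-zeroˡ (F j))
  vanish (suc i) 1+i<1+j =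
    trans (cong (c (suc i) *_) (F≡0 (j ∸ suc i) (ℕₚ.∸-monoʳ-< (s≤s z≤n) (ℕₚ.≤-pred 1+i<1+j))))
          (ℚₚ.*-zeroʳ (c (suc i)))

powP-order : ∀ c → c 0 ≡ 0ℚ → ∀ k j → j < k → powP c k j ≡ 0ℚ
powP-order c c₀≡0 (suc k) j j<1+k = trans (*P-comm (powP c k) c j)
  (*P-vanishes c (powP c k) j c₀≡0
    (λ i i<j → powP-order c c₀≡0 k i (ℕₚ.<-≤-trans i<j (ℕₚ.≤-pred j<1+k))))

*P-powP-complement : ∀ a k → a *P powP (oneP -P a) k ≗ powP (oneP -P a) k -P powP (oneP -P a) (suc k)
*P-powP-complement a k j = begin
  (a *P cᵏ) j                                   ≡⟨ *P-comm a cᵏ j ⟩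
  (cᵏ *P a) j                                   ≡⟨ solve 2 (λ x y → y := x :- (x :- y)) refl (cᵏ j) _ ⟩
  cᵏ j - (cᵏ j - (cᵏ *P a) j)                   ≡⟨ cong (λ z → cᵏ j - (z - (cᵏ *P a) j)) (*P-identityʳ cᵏ j) ⟨
  cᵏ j - ((cᵏ *P oneP) j - (cᵏ *P a) j)         ≡⟨ cong (_-_ (cᵏ j)) (*P-distribˡ-minus cᵏ oneP a j) ⟨
  cᵏ j - powP (oneP -P a) (suc k) j             ∎
  where
  open ≡-Reasoning
  cᵏ : PS
  cᵏ = powP (oneP -P a) k

*P-geometric-sum : ∀ a K → a *P sumLtP K (powP (oneP -P a)) ≗ oneP -P powP (oneP -P a) K
*P-geometric-sum a K = begin
  a *P sumLtP K (powP c)                      ≈⟨ *P-distribˡ-sumLtP K a (powP c) ⟩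
  sumLtP K (λ k → a *P powP c k)              ≈⟨ (λ j → sumLt-cong K (λ k → *P-powP-complement a k j)) ⟩
  sumLtP K (λ k → powP c k -P powP c (suc k)) ≈⟨ (λ j → sumLt-telescope K (λ k → powP c k j)) ⟩
  oneP -P powP c K                            ∎
  where
  open ≗-Reasoning
  c : PS
  c = oneP -P a

invOne-inverseʳ : ∀ a → a 0 ≡ 1ℚ → a *P invOne a ≗ oneP
invOne-inverseʳ a a₀≡1 j = begin
  (a *P invOne a) j       ≡⟨ *P-cong-≤ j {a} {a} (λ _ _ → refl) truncate ⟩
  (a *P S (suc j)) j      ≡⟨ *P-geometric-sum a (suc j) j ⟩
  oneP j - powP c (suc j) j ≡⟨ cong (_-_ (oneP j)) (powP-order c c₀≡0 (suc j) j ℕₚ.≤-refl) ⟩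
  oneP j - 0ℚ             ≡⟨ ℚₚ.+-identityʳ (oneP j) ⟩
  oneP j                  ∎
  where
  open ≡-Reasoning
  c : PS
  c = oneP -P a
  S : ℕ → PS
  S K = sumLtP K (powP c)
  c₀≡0 : c 0 ≡ 0ℚ
  c₀≡0 = trans (cong (_-_ 1ℚ) a₀≡1) (ℚₚ.+-inverseʳ 1ℚ)
  truncate : ∀ i → i ≤ j → invOne a i ≡ S (suc j) i
  truncate i i≤j = sym (sumLt-vanishing-tail (suc i) (suc j) (s≤s i≤j)
                                             (λ k i<k _ → powP-order c c₀≡0 k i i<k))

bracket-*P-inverse : ∀ n → 0 < n → bracket n *P invOne (bracket n) ≗ oneP
bracket-*P-inverse (suc n) _ = invOne-inverseʳ (bracket (suc n)) refl

-- Multivariate series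

MPS-setoid : ℕ → Setoid _ _
MPS-setoid r = record
  { Carrier       = MPS r
  ; _≈_           = _≈M_
  ; isEquivalence = record
    { refl  = λ _ _ → refl
    ; sym   = λ f≈g α j → sym (f≈g α j)
    ; trans = λ f≈g g≈h α j → trans (f≈g α j) (g≈h α j)
    }
  }

module ≈M-Reasoning {r} = SetoidReasoning (MPS-setoid r)

≈M-sym : ∀ {r} {F G : MPS r} → F ≈M G → G ≈M F
≈M-sym = Setoid.sym (MPS-setoid _)

≈M-trans : ∀ {r} {F G H : MPS r} → F ≈M G → G ≈M H → F ≈M H
≈M-trans = Setoid.trans (MPS-setoid _)

infixr 7 _·M_

_·M_ : ∀ {r} → PS → MPS r → MPS r
(c ·M F) α = c *P F α

slice : ∀ {s} → MPS (suc s) → ℕ → ℕ → MPS s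
slice F l k β = F ((l , k) ∷ β)

shiftY1 : ∀ {s} → MPS (suc s) → MPS (suc s)
shiftY1 F ((zero  , k) ∷ β) = zeroP
shiftY1 F ((suc l , k) ∷ β) = F ((l , k) ∷ β)

shiftX1 : ∀ {s} → MPS (suc s) → MPS (suc s)
shiftX1 F ((l , zero)  ∷ β) = zeroP
shiftX1 F ((l , suc k) ∷ β) = F ((l , k) ∷ β)

-- onXaxis c E = Σ_k c_k ⟨X₁⟩^k E(Y₂,X₂,…)
onXaxis : ∀ {s} → (ℕ → PS) → MPS s → MPS (suc s)
onXaxis c E ((zero  , k) ∷ β) = c k *P E β
onXaxis c E ((suc l , k) ∷ β) = zeroP

+M-cong : ∀ {r} {F F′ G G′ : MPS r} → F ≈M F′ → G ≈M G′ → F +M G ≈M F′ +M G′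
+M-cong F≈F′ G≈G′ α = +P-cong (F≈F′ α) (G≈G′ α)

-M-cong : ∀ {r} {F F′ G G′ : MPS r} → F ≈M F′ → G ≈M G′ → F -M G ≈M F′ -M G′
-M-cong F≈F′ G≈G′ α = -P-cong (F≈F′ α) (G≈G′ α)

+M-congˡ : ∀ {r} (F : MPS r) {G G′ : MPS r} → G ≈M G′ → F +M G ≈M F +M G′
+M-congˡ F G≈G′ α = +P-cong {F α} ≗-refl (G≈G′ α)

-M-congˡ : ∀ {r} (F : MPS r) {G G′ : MPS r} → G ≈M G′ → F -M G ≈M F -M G′
-M-congˡ F G≈G′ α = -P-cong {F α} ≗-refl (G≈G′ α)

·M-congˡ : ∀ {r} c {F F′ : MPS r} → F ≈M F′ → c ·M F ≈M c ·M F′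
·M-congˡ c F≈F′ α = *P-congˡ c (F≈F′ α)

sumSub-cong : ∀ {r} (α : Idx r) {h h′ : Idx r → Idx r → PS} →
  (∀ β γ → h β γ ≗ h′ β γ) → sumSub α h ≗ sumSub α h′
sumSub-cong []            h≗h′ = h≗h′ [] []
sumSub-cong ((a , b) ∷ α) h≗h′ j = sumLt-cong (suc a) (λ i → sumLt-cong (suc b) (λ k →
  sumSub-cong α (λ β γ → h≗h′ ((i , k) ∷ β) ((a ∸ i , b ∸ k) ∷ γ)) j))

sumSub-zero : ∀ {r} (α : Idx r) {h : Idx r → Idx r → PS} →
  (∀ β γ → h β γ ≗ zeroP) → sumSub α h ≗ zeroP
sumSub-zero []            h≗0 = h≗0 [] []
sumSub-zero ((a , b) ∷ α) h≗0 j = sumLt-zero (suc a) (λ i _ → sumLt-zero (suc b) (λ k _ →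
  sumSub-zero α (λ β γ → h≗0 ((i , k) ∷ β) ((a ∸ i , b ∸ k) ∷ γ)) j))

sumSub-homomorphic : (_⊕_ : ℚ → ℚ → ℚ) →
  (∀ n f g → sumLt n (λ i → f i ⊕ g i) ≡ sumLt n f ⊕ sumLt n g) →
  ∀ {r} (α : Idx r) h h′ j →
  sumSub α (λ β γ j′ → h β γ j′ ⊕ h′ β γ j′) j ≡ sumSub α h j ⊕ sumSub α h′ j
sumSub-homomorphic _⊕_ hom []            h h′ j = refl
sumSub-homomorphic _⊕_ hom {suc r} ((a , b) ∷ α) h h′ j = begin
  sumLt (suc a) (λ i → sumLt (suc b) (λ k → sumSub α (λ β γ j′ → H i k β γ j′ ⊕ H′ i k β γ j′) j))
    ≡⟨ sumLt-cong (suc a) (λ i → sumLt-cong (suc b) (λ k →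
         sumSub-homomorphic _⊕_ hom α (H i k) (H′ i k) j)) ⟩
  sumLt (suc a) (λ i → sumLt (suc b) (λ k → sumSub α (H i k) j ⊕ sumSub α (H′ i k) j))
    ≡⟨ sumLt-cong (suc a) (λ i → hom (suc b) _ _) ⟩
  sumLt (suc a) (λ i → sumLt (suc b) (λ k → sumSub α (H i k) j)
                     ⊕ sumLt (suc b) (λ k → sumSub α (H′ i k) j))
    ≡⟨ hom (suc a) _ _ ⟩
  sumSub ((a , b) ∷ α) h j ⊕ sumSub ((a , b) ∷ α) h′ j
    ∎
  where
  open ≡-Reasoning
  H H′ : ℕ → ℕ → Idx r → Idx r → PS
  H  i k β γ = h  ((i , k) ∷ β) ((a ∸ i , b ∸ k) ∷ γ)
  H′ i k β γ = h′ ((i , k) ∷ β) ((a ∸ i , b ∸ k) ∷ γ)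

*P-distribˡ-sumSub : ∀ {r} (α : Idx r) c h → c *P sumSub α h ≗ sumSub α (λ β γ → c *P h β γ)
*P-distribˡ-sumSub []            c h = λ _ → refl
*P-distribˡ-sumSub {suc r} ((a , b) ∷ α) c h = begin
  c *P sumLtP (suc a) (λ i → sumLtP (suc b) (λ k → sumSub α (H i k)))
    ≈⟨ *P-distribˡ-sumLtP (suc a) c (λ i → sumLtP (suc b) (λ k → sumSub α (H i k))) ⟩
  sumLtP (suc a) (λ i → c *P sumLtP (suc b) (λ k → sumSub α (H i k)))
    ≈⟨ (λ j → sumLt-cong (suc a) (λ i → *P-distribˡ-sumLtP (suc b) c (λ k → sumSub α (H i k)) j)) ⟩
  sumLtP (suc a) (λ i → sumLtP (suc b) (λ k → c *P sumSub α (H i k)))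
    ≈⟨ (λ j → sumLt-cong (suc a) (λ i → sumLt-cong (suc b) (λ k → *P-distribˡ-sumSub α c (H i k) j))) ⟩
  sumSub ((a , b) ∷ α) (λ β γ → c *P h β γ)
    ∎
  where
  open ≗-Reasoning
  H : ℕ → ℕ → Idx r → Idx r → PS
  H i k β γ = h ((i , k) ∷ β) ((a ∸ i , b ∸ k) ∷ γ)

sumSub-swap : ∀ {r} (α : Idx r) h → sumSub α h ≗ sumSub α (λ β γ → h γ β)
sumSub-swap []            h j = refl
sumSub-swap ((a , b) ∷ α) h j = begin
  sumLt (suc a) (λ i → sumLt (suc b) (λ k → S i k (a ∸ i) (b ∸ k)))
    ≡⟨ sumLt-cong (suc a) (λ i → sumLt-cong (suc b) (λ k → sumSub-swap α _ j)) ⟩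
  sumLt (suc a) (λ i → sumLt (suc b) (λ k → S′ i k (a ∸ i) (b ∸ k)))
    ≡⟨ sumLt-reflect a (λ i i′ → sumLt (suc b) (λ k → S′ i k i′ (b ∸ k))) ⟩
  sumLt (suc a) (λ i → sumLt (suc b) (λ k → S′ (a ∸ i) k i (b ∸ k)))
    ≡⟨ sumLt-cong (suc a) (λ i → sumLt-reflect b (λ k k′ → S′ (a ∸ i) k i k′)) ⟩
  sumLt (suc a) (λ i → sumLt (suc b) (λ k → S′ (a ∸ i) (b ∸ k) i k))
    ∎
  where
  open ≡-Reasoning
  S S′ : ℕ → ℕ → ℕ → ℕ → ℚ
  S  i k i′ k′ = sumSub α (λ β γ → h ((i , k) ∷ β) ((i′ , k′) ∷ γ)) j
  S′ i k i′ k′ = sumSub α (λ β γ → h ((i , k) ∷ γ) ((i′ , k′) ∷ β)) j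

sumSub-vanishing : ∀ {r} a b (α : Idx r) h →
  (∀ i k → i ≤ a → k ≤ b → ∀ β γ → h ((i , k) ∷ β) ((a ∸ i , b ∸ k) ∷ γ) ≗ zeroP) →
  sumSub ((a , b) ∷ α) h ≗ zeroP
sumSub-vanishing a b α h h≗0 j = sumLt-zero (suc a) (λ i i<1+a → sumLt-zero (suc b) (λ k k<1+b →
  sumSub-zero α (h≗0 i k (ℕₚ.≤-pred i<1+a) (ℕₚ.≤-pred k<1+b)) j))

sumSub-single : ∀ {r} a b (α : Idx r) h i₀ k₀ → i₀ ≤ a → k₀ ≤ b →
  (∀ i k → i ≤ a → k ≤ b → (i , k) ≢ (i₀ , k₀) →
     ∀ β γ → h ((i , k) ∷ β) ((a ∸ i , b ∸ k) ∷ γ) ≗ zeroP) →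
  sumSub ((a , b) ∷ α) h ≗ sumSub α (λ β γ → h ((i₀ , k₀) ∷ β) ((a ∸ i₀ , b ∸ k₀) ∷ γ))
sumSub-single a b α h i₀ k₀ i₀≤a k₀≤b h≗0 j =
  trans (sumLt-single (suc a) i₀ (s≤s i₀≤a) (λ i i<1+a i≢i₀ → sumLt-zero (suc b) (λ k k<1+b →
           sumSub-zero α (h≗0 i k (ℕₚ.≤-pred i<1+a) (ℕₚ.≤-pred k<1+b) (i≢i₀ ∘ cong proj₁)) j)))
        (sumLt-single (suc b) k₀ (s≤s k₀≤b) (λ k k<1+b k≢k₀ →
           sumSub-zero α (h≗0 i₀ k i₀≤a (ℕₚ.≤-pred k<1+b) (k≢k₀ ∘ cong proj₂)) j))

*M-cong : ∀ {r} {F F′ G G′ : MPS r} → F ≈M F′ → G ≈M G′ → F *M G ≈M F′ *M G′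
*M-cong F≈F′ G≈G′ α = sumSub-cong α (λ β γ → *P-cong (F≈F′ β) (G≈G′ γ))

*M-congʳ : ∀ {r} (G : MPS r) {F F′ : MPS r} → F ≈M F′ → F *M G ≈M F′ *M G
*M-congʳ G F≈F′ = *M-cong {G = G} F≈F′ (λ _ _ → refl)

*M-comm : ∀ {r} (F G : MPS r) → F *M G ≈M G *M F
*M-comm F G α = ≗-trans (sumSub-swap α (λ β γ → F β *P G γ))
                        (sumSub-cong α (λ β γ → *P-comm (F γ) (G β)))

*M-distribʳ-+M : ∀ {r} (H F G : MPS r) → (F +M G) *M H ≈M F *M H +M G *M H
*M-distribʳ-+M H F G α j =
  trans (sumSub-cong α (λ β γ → *P-distribʳ-+P (H γ) (F β) (G β)) j)
        (sumSub-homomorphic _+_ sumLt-distrib-+ α (λ β γ → F β *P H γ) (λ β γ → G β *P H γ) j)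

*M-distribʳ-minus : ∀ {r} (H F G : MPS r) → (F -M G) *M H ≈M F *M H -M G *M H
*M-distribʳ-minus H F G α j =
  trans (sumSub-cong α (λ β γ → *P-distribʳ-minus (H γ) (F β) (G β)) j)
        (sumSub-homomorphic _-_ sumLt-distrib-minus α (λ β γ → F β *P H γ) (λ β γ → G β *P H γ) j)

*M-distribˡ-minus : ∀ {r} (H F G : MPS r) → H *M (F -M G) ≈M H *M F -M H *M G
*M-distribˡ-minus H F G α j =
  trans (sumSub-cong α (λ β γ → *P-distribˡ-minus (H β) (F γ) (G γ)) j)
        (sumSub-homomorphic _-_ sumLt-distrib-minus α (λ β γ → H β *P F γ) (λ β γ → H β *P G γ) j)

·M-*M : ∀ {r} c (F G : MPS r) → (c ·M F) *M G ≈M c ·M (F *M G)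
·M-*M c F G α = ≗-trans (sumSub-cong α (λ β γ → *P-assoc c (F β) (G γ)))
                        (≗-sym (*P-distribˡ-sumSub α c (λ β γ → F β *P G γ)))

constM-off-origin : ∀ {r} c i k (β : Idx r) → (i , k) ≢ (0 , 0) → constM c ((i , k) ∷ β) ≗ zeroP
constM-off-origin c zero    zero    β ik≢00 = ⊥-elim (ik≢00 refl)
constM-off-origin c zero    (suc k) β _     = ≗-refl
constM-off-origin c (suc i) k       β _     = ≗-refl

constM-*M : ∀ {r} c (F : MPS r) → constM c *M F ≈M c ·M F
constM-*M c F []            = ≗-refl
constM-*M c F ((a , b) ∷ α) = ≗-trans
  (sumSub-single a b α (λ β γ → constM c β *P F γ) 0 0 z≤n z≤n
    (λ i k _ _ ik≢00 β γ → zero-*P (F ((a ∸ i , b ∸ k) ∷ γ)) (constM-off-origin c i k β ik≢00)))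
  (constM-*M c (slice F a b) α)

oneM-*M : ∀ {r} (F : MPS r) → oneM *M F ≈M F
oneM-*M F α = ≗-trans (constM-*M oneP F α) (*P-identityˡ (F α))

*M-constM : ∀ {r} c (F : MPS r) → F *M constM c ≈M c ·M F
*M-constM c F α = ≗-trans (*M-comm F (constM c) α) (constM-*M c F α)

*M-oneM : ∀ {r} (F : MPS r) → F *M oneM ≈M F
*M-oneM F α = ≗-trans (*M-comm F oneM α) (oneM-*M F α)

varY1-off : ∀ {r} i k (β : Idx r) → (i , k) ≢ (1 , 0) → varY1 ((i , k) ∷ β) ≗ zeroP
varY1-off zero          k       β _     = ≗-refl
varY1-off (suc zero)    zero    β ik≢10 = ⊥-elim (ik≢10 refl)
varY1-off (suc zero)    (suc k) β _     = ≗-refl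
varY1-off (suc (suc i)) k       β _     = ≗-refl

varX1-off : ∀ {r} i k (β : Idx r) → (i , k) ≢ (0 , 1) → varX1 ((i , k) ∷ β) ≗ zeroP
varX1-off (suc i) k             β _     = ≗-refl
varX1-off zero    zero          β _     = ≗-refl
varX1-off zero    (suc zero)    β ik≢01 = ⊥-elim (ik≢01 refl)
varX1-off zero    (suc (suc k)) β _     = ≗-refl

embed-off : ∀ {s} (E : MPS s) i k β → (i , k) ≢ (0 , 0) → embed E ((i , k) ∷ β) ≗ zeroP
embed-off E zero    zero    β ik≢00 = ⊥-elim (ik≢00 refl)
embed-off E zero    (suc k) β _     = ≗-refl
embed-off E (suc i) k       β _     = ≗-refl

varY1-*M : ∀ {s} (F : MPS (suc s)) → varY1 *M F ≈M shiftY1 F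
varY1-*M F ((zero , k) ∷ β) = sumSub-vanishing 0 k β (λ β′ γ → varY1 β′ *P F γ)
  (λ { zero k′ _ _ β′ γ → *P-zeroˡ (F ((0 , k ∸ k′) ∷ γ)) })
varY1-*M F ((suc l , k) ∷ β) = ≗-trans
  (sumSub-single (suc l) k β (λ β′ γ → varY1 β′ *P F γ) 1 0 (s≤s z≤n) z≤n
    (λ i k′ _ _ ik′≢10 β′ γ → zero-*P (F ((suc l ∸ i , k ∸ k′) ∷ γ)) (varY1-off i k′ β′ ik′≢10)))
  (oneM-*M (slice F l k) β)

varX1-*M : ∀ {s} (F : MPS (suc s)) → varX1 *M F ≈M shiftX1 F
varX1-*M F ((l , zero) ∷ β) = sumSub-vanishing l 0 β (λ β′ γ → varX1 β′ *P F γ)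
  (λ { i zero _ _ β′ γ → zero-*P (F ((l ∸ i , 0) ∷ γ)) (varX1-off i 0 β′ (λ ())) })
varX1-*M F ((l , suc k) ∷ β) = ≗-trans
  (sumSub-single l (suc k) β (λ β′ γ → varX1 β′ *P F γ) 0 1 z≤n (s≤s z≤n)
    (λ i k′ _ _ ik′≢01 β′ γ → zero-*P (F ((l ∸ i , suc k ∸ k′) ∷ γ)) (varX1-off i k′ β′ ik′≢01)))
  (oneM-*M (slice F l k) β)

embed-*M : ∀ {s} (E : MPS s) (F : MPS (suc s)) l k β → (embed E *M F) ((l , k) ∷ β) ≗ (E *M slice F l k) β
embed-*M E F l k β = sumSub-single l k β (λ β′ γ → embed E β′ *P F γ) 0 0 z≤n z≤n
  (λ i k′ _ _ ik′≢00 β′ γ → zero-*P (F ((l ∸ i , k ∸ k′) ∷ γ)) (embed-off E i k′ β′ ik′≢00))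

constM-cong : ∀ {r} {c d} → c ≗ d → constM {r} c ≈M constM d
constM-cong c≗d α with isZeroIdx α
... | true  = c≗d
... | false = ≗-refl

·M-constM : ∀ {r} c d → c ·M constM {r} d ≈M constM (c *P d)
·M-constM c d α with isZeroIdx α
... | true  = ≗-refl
... | false = *P-zeroʳ c

·M-distrib-minus : ∀ {r} c (F G : MPS r) → c ·M (F -M G) ≈M c ·M F -M c ·M G
·M-distrib-minus c F G α = *P-distribˡ-minus c (F α) (G α)

·M-shiftY1 : ∀ {s} c (F : MPS (suc s)) → c ·M shiftY1 F ≈M shiftY1 (c ·M F)
·M-shiftY1 c F ((zero  , k) ∷ β) = *P-zeroʳ c
·M-shiftY1 c F ((suc l , k) ∷ β) = ≗-refl

·M-onXaxis : ∀ {s} c d (E : MPS s) → c ·M onXaxis d E ≈M onXaxis (λ k → c *P d k) E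
·M-onXaxis c d E ((zero  , k) ∷ β) = ≗-sym (*P-assoc c (d k) (E β))
·M-onXaxis c d E ((suc l , k) ∷ β) = *P-zeroʳ c

onXaxis-congʳ : ∀ {s} c {E E′ : MPS s} → E ≈M E′ → onXaxis c E ≈M onXaxis c E′
onXaxis-congʳ c E≈E′ ((zero  , k) ∷ β) = *P-congˡ (c k) (E≈E′ β)
onXaxis-congʳ c E≈E′ ((suc l , k) ∷ β) = ≗-refl

onXaxis-*M-embed : ∀ {s} c (E′ E : MPS s) → onXaxis c E′ *M embed E ≈M onXaxis c (E′ *M E)
onXaxis-*M-embed c E′ E ((zero , k) ∷ β) = begin
  (onXaxis c E′ *M embed E) ((0 , k) ∷ β)   ≈⟨ *M-comm (onXaxis c E′) (embed E) ((0 , k) ∷ β) ⟩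
  (embed E *M onXaxis c E′) ((0 , k) ∷ β)   ≈⟨ embed-*M E (onXaxis c E′) 0 k β ⟩
  (E *M (c k ·M E′)) β                      ≈⟨ *M-comm E (c k ·M E′) β ⟩
  ((c k ·M E′) *M E) β                      ≈⟨ ·M-*M (c k) E′ E β ⟩
  c k *P (E′ *M E) β                        ∎
  where open ≗-Reasoning
onXaxis-*M-embed c E′ E ((suc l , k) ∷ β) = begin
  (onXaxis c E′ *M embed E) ((suc l , k) ∷ β)   ≈⟨ *M-comm (onXaxis c E′) (embed E) ((suc l , k) ∷ β) ⟩
  (embed E *M onXaxis c E′) ((suc l , k) ∷ β)   ≈⟨ embed-*M E (onXaxis c E′) (suc l) k β ⟩
  (E *M (λ _ → zeroP)) β                        ≈⟨ sumSub-zero β (λ β′ _ → *P-zeroʳ (E β′)) ⟩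
  zeroP                                         ∎
  where open ≗-Reasoning

[⟨A⟩-Y₁]⟨A⟩⁻¹-*M : ∀ {s} A Ā (F : MPS (suc s)) → A *P Ā ≗ oneP →
  (constM A -M varY1) *M constM Ā *M F ≈M F -M shiftY1 (Ā ·M F)
[⟨A⟩-Y₁]⟨A⟩⁻¹-*M A Ā F AĀ≗1 = begin
  (constM A -M varY1) *M constM Ā *M F         ≈⟨ *M-congʳ F (*M-constM Ā (constM A -M varY1)) ⟩
  (Ā ·M (constM A -M varY1)) *M F              ≈⟨ *M-congʳ F (·M-distrib-minus Ā (constM A) varY1) ⟩
  (Ā ·M constM A -M Ā ·M varY1) *M F           ≈⟨ *M-distribʳ-minus F (Ā ·M constM A) (Ā ·M varY1) ⟩
  (Ā ·M constM A) *M F -M (Ā ·M varY1) *M F    ≈⟨ -M-cong (*M-congʳ F ĀA≈1) (·M-*M Ā varY1 F) ⟩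
  oneM *M F -M Ā ·M (varY1 *M F)               ≈⟨ -M-cong (oneM-*M F) (·M-congˡ Ā (varY1-*M F)) ⟩
  F -M Ā ·M shiftY1 F                          ≈⟨ -M-congˡ F (·M-shiftY1 Ā F) ⟩
  F -M shiftY1 (Ā ·M F)                        ∎
  where
  open ≈M-Reasoning
  ĀA≈1 : Ā ·M constM A ≈M oneM
  ĀA≈1 = begin
    Ā ·M constM A      ≈⟨ ·M-constM Ā A ⟩
    constM (Ā *P A)    ≈⟨ constM-cong (≗-trans (*P-comm Ā A) AĀ≗1) ⟩
    oneM               ∎

[1+cY₁]-*M : ∀ {s} c (F : MPS (suc s)) → powM (oneM +M constM c *M varY1) 1 *M F ≈M F +M shiftY1 (c ·M F)
[1+cY₁]-*M c F = begin
  powM (oneM +M constM c *M varY1) 1 *M F   ≈⟨ *M-congʳ F (oneM-*M (oneM +M constM c *M varY1)) ⟩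
  (oneM +M constM c *M varY1) *M F          ≈⟨ *M-distribʳ-+M F oneM (constM c *M varY1) ⟩
  oneM *M F +M (constM c *M varY1) *M F     ≈⟨ +M-cong (oneM-*M F) (*M-congʳ F (constM-*M c varY1)) ⟩
  F +M (c ·M varY1) *M F                    ≈⟨ +M-congˡ F (·M-*M c varY1 F) ⟩
  F +M c ·M (varY1 *M F)                    ≈⟨ +M-congˡ F (·M-congˡ c (varY1-*M F)) ⟩
  F +M c ·M shiftY1 F                       ≈⟨ +M-congˡ F (·M-shiftY1 c F) ⟩
  F +M shiftY1 (c ·M F)                     ∎
  where open ≈M-Reasoning

module InverseOfConstMinusX1 {s : ℕ} (B : PS) (B₀≡1 : B 0 ≡ 1ℚ) where

  H : MPS (suc s)
  H = constM B -M varX1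

  P : ℕ → MPS (suc s)
  P = powM (oneM -M H)

  I : MPS (suc s)
  I = invM H

  *M-H : ∀ F → F *M H ≈M B ·M F -M shiftX1 F
  *M-H F = begin
    F *M (constM B -M varX1)            ≈⟨ *M-distribˡ-minus F (constM B) varX1 ⟩
    F *M constM B -M F *M varX1         ≈⟨ -M-cong (*M-constM B F) (*M-comm F varX1) ⟩
    B ·M F -M varX1 *M F                ≈⟨ -M-congˡ (B ·M F) (varX1-*M F) ⟩
    B ·M F -M shiftX1 F                 ∎
    where open ≈M-Reasoning

  *M-[1-H] : ∀ F → F *M (oneM -M H) ≈M F -M (B ·M F -M shiftX1 F)
  *M-[1-H] F = begin
    F *M (oneM -M H)           ≈⟨ *M-distribˡ-minus F oneM H ⟩
    F *M oneM -M F *M H        ≈⟨ -M-cong (*M-oneM F) (*M-H F) ⟩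
    F -M (B ·M F -M shiftX1 F) ∎
    where open ≈M-Reasoning

  -- (1 - H)^(k+1) = (1 - B) (1 - H)^k + ⟨X₁⟩ (1 - H)^k and 1 - B has no constant term, so every
  -- factor 1 - H raises the q-degree plus the total degree in the variables by at least one.
  powM-order : ∀ k α j → totDeg α ℕ.+ j < k → P k α j ≡ 0ℚ
  powM-order (suc k) α j d<1+k = begin
    P (suc k) α j
      ≡⟨ *M-[1-H] (P k) α j ⟩
    P k α j - ((B *P P k α) j - shiftX1 (P k) α j)
      ≡⟨ solve 3 (λ x y z → x :- (y :- z) := (x :- y) :+ z) refl (P k α j) _ _ ⟩
    (P k α j - (B *P P k α) j) + shiftX1 (P k) α j
      ≡⟨ cong (_+ shiftX1 (P k) α j) complement ⟩
    ((oneP -P B) *P P k α) j + shiftX1 (P k) α j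
      ≡⟨ cong₂ _+_ low (shifted α d<1+k) ⟩
    0ℚ + 0ℚ
      ≡⟨ ℚₚ.+-identityˡ 0ℚ ⟩
    0ℚ ∎
    where
    open ≡-Reasoning
    complement : P k α j - (B *P P k α) j ≡ ((oneP -P B) *P P k α) j
    complement = trans (cong (_- (B *P P k α) j) (sym (*P-identityˡ (P k α) j)))
                       (sym (*P-distribʳ-minus (P k α) oneP B j))
    low : ((oneP -P B) *P P k α) j ≡ 0ℚ
    low = *P-vanishes (oneP -P B) (P k α) j (trans (cong (_-_ 1ℚ) B₀≡1) (ℚₚ.+-inverseʳ 1ℚ))
            (λ i i<j → powM-order k α i
                         (ℕₚ.<-≤-trans (ℕₚ.+-monoʳ-< (totDeg α) i<j) (ℕₚ.≤-pred d<1+k)))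
    shifted : ∀ α → totDeg α ℕ.+ j < suc k → shiftX1 (P k) α j ≡ 0ℚ
    shifted ((a , zero)  ∷ γ) _ = refl
    shifted ((a , suc b) ∷ γ) d<1+k = powM-order k ((a , b) ∷ γ) j
      (ℕₚ.≤-pred (subst (λ z → z ℕ.+ totDeg γ ℕ.+ j < suc k) (ℕₚ.+-suc a b) d<1+k))

  invM-truncate : ∀ K α j → totDeg α ℕ.+ j < K → I α j ≡ sumLt K (λ k → P k α j)
  invM-truncate K α j d<K = sym (sumLt-vanishing-tail (suc (totDeg α ℕ.+ j)) K d<K
                                                      (λ k d<k _ → powM-order k α j d<k))

  invM-inverseˡ : I *M H ≈M oneM
  invM-inverseˡ α j = begin
    (I *M H) α j
      ≡⟨ *M-H I α j ⟩
    (B *P I α) j - shiftX1 I α j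
      ≡⟨ cong₂ _-_ (*P-cong-≤ j {B} {B} (λ _ _ → refl) truncate) (truncate-shifted α ℕₚ.≤-refl) ⟩
    (B *P sumLtP K (λ k → P k α)) j - sumLt K (λ k → shiftX1 (P k) α j)
      ≡⟨ cong (_- sumLt K (λ k → shiftX1 (P k) α j)) (*P-distribˡ-sumLtP K B (λ k → P k α) j) ⟩
    sumLt K (λ k → (B *P P k α) j) - sumLt K (λ k → shiftX1 (P k) α j)
      ≡⟨ sumLt-distrib-minus K _ _ ⟨
    sumLt K (λ k → (B *P P k α) j - shiftX1 (P k) α j)
      ≡⟨ sumLt-cong K step ⟩
    sumLt K (λ k → P k α j - P (suc k) α j)
      ≡⟨ sumLt-telescope K (λ k → P k α j) ⟩
    oneM α j - P K α j
      ≡⟨ cong (_-_ (oneM α j)) (powM-order K α j ℕₚ.≤-refl) ⟩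
    oneM α j - 0ℚ
      ≡⟨ ℚₚ.+-identityʳ (oneM α j) ⟩
    oneM α j ∎
    where
    open ≡-Reasoning
    K : ℕ
    K = suc (totDeg α ℕ.+ j)
    truncate : ∀ i → i ≤ j → I α i ≡ sumLtP K (λ k → P k α) i
    truncate i i≤j = invM-truncate K α i (s≤s (ℕₚ.+-monoʳ-≤ (totDeg α) i≤j))
    truncate-shifted : ∀ α′ → totDeg α′ ℕ.+ j < K →
                       shiftX1 I α′ j ≡ sumLt K (λ k → shiftX1 (P k) α′ j)
    truncate-shifted ((a , zero)  ∷ γ) _   = sym (sumLt-zero K (λ _ _ → refl))
    truncate-shifted ((a , suc b) ∷ γ) d<K = invM-truncate K ((a , b) ∷ γ) j
      (ℕₚ.<-≤-trans (s≤s (ℕₚ.+-monoˡ-≤ j (ℕₚ.+-monoˡ-≤ (totDeg γ) (ℕₚ.+-monoʳ-≤ a (ℕₚ.n≤1+n b)))))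
                    d<K)
    step : ∀ k → (B *P P k α) j - shiftX1 (P k) α j ≡ P k α j - P (suc k) α j
    step k = trans (solve 2 (λ x y → y := x :- (x :- y)) refl (P k α j) _)
                   (cong (_-_ (P k α j)) (sym (*M-[1-H] (P k) α j)))

  B⁻¹ : PS
  B⁻¹ = invOne B

  invM-recursion : ∀ α → I α ≗ B⁻¹ *P (oneM α +P shiftX1 I α)
  invM-recursion α = begin
    I α                                     ≈⟨ *P-identityˡ (I α) ⟨
    oneP *P I α                             ≈⟨ *P-congʳ (I α) B⁻¹B≗1 ⟨
    (B⁻¹ *P B) *P I α                       ≈⟨ *P-assoc B⁻¹ B (I α) ⟩
    B⁻¹ *P (B *P I α)                       ≈⟨ *P-congˡ B⁻¹ BI≗1+shift ⟩
    B⁻¹ *P (oneM α +P shiftX1 I α)          ∎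
    where
    open ≗-Reasoning
    B⁻¹B≗1 : B⁻¹ *P B ≗ oneP
    B⁻¹B≗1 = ≗-trans (*P-comm B⁻¹ B) (invOne-inverseʳ B B₀≡1)
    BI≗1+shift : B *P I α ≗ oneM α +P shiftX1 I α
    BI≗1+shift j = trans (solve 2 (λ x y → x := (x :- y) :+ y) refl ((B *P I α) j) (shiftX1 I α j))
                         (cong (_+ shiftX1 I α j) (trans (sym (*M-H I α j)) (invM-inverseˡ α j)))

  invM-coefficients : I ≈M onXaxis (λ k → powP B⁻¹ (suc k)) oneM
  invM-coefficients ((l , k) ∷ β) = coefficient l k β
    where
    coefficient : ∀ l k β → I ((l , k) ∷ β) ≗ onXaxis (λ k → powP B⁻¹ (suc k)) oneM ((l , k) ∷ β)
    coefficient zero zero β = begin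
      I ((0 , 0) ∷ β)                      ≈⟨ invM-recursion ((0 , 0) ∷ β) ⟩
      B⁻¹ *P (oneM β +P zeroP)             ≈⟨ *P-congˡ B⁻¹ (+P-identityʳ (oneM β)) ⟩
      B⁻¹ *P oneM β                        ≈⟨ *P-congʳ (oneM β) (*P-identityˡ B⁻¹) ⟨
      powP B⁻¹ 1 *P oneM β                 ∎
      where open ≗-Reasoning
    coefficient zero (suc k) β = begin
      I ((0 , suc k) ∷ β)                           ≈⟨ invM-recursion ((0 , suc k) ∷ β) ⟩
      B⁻¹ *P (zeroP +P I ((0 , k) ∷ β))             ≈⟨ *P-congˡ B⁻¹ (+P-identityˡ (I ((0 , k) ∷ β))) ⟩
      B⁻¹ *P I ((0 , k) ∷ β)                        ≈⟨ *P-congˡ B⁻¹ (coefficient 0 k β) ⟩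
      B⁻¹ *P (powP B⁻¹ (suc k) *P oneM β)           ≈⟨ *P-assoc B⁻¹ (powP B⁻¹ (suc k)) (oneM β) ⟨
      (B⁻¹ *P powP B⁻¹ (suc k)) *P oneM β           ≈⟨ *P-congʳ (oneM β) (*P-comm B⁻¹ (powP B⁻¹ (suc k))) ⟩
      powP B⁻¹ (suc (suc k)) *P oneM β              ∎
      where open ≗-Reasoning
    coefficient (suc l) k β = begin
      I ((suc l , k) ∷ β)
        ≈⟨ invM-recursion ((suc l , k) ∷ β) ⟩
      B⁻¹ *P (zeroP +P shiftX1 I ((suc l , k) ∷ β))
        ≈⟨ *P-congˡ B⁻¹ (≗-trans (+P-identityˡ _) (shifted k)) ⟩
      B⁻¹ *P zeroP
        ≈⟨ *P-zeroʳ B⁻¹ ⟩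
      zeroP ∎
      where
      open ≗-Reasoning
      shifted : ∀ k → shiftX1 I ((suc l , k) ∷ β) ≗ zeroP
      shifted zero    = ≗-refl
      shifted (suc k) = coefficient (suc l) k β

onXaxis-congˡ : ∀ {s} {c d : ℕ → PS} (E : MPS s) → (∀ k → c k ≗ d k) → onXaxis c E ≈M onXaxis d E
onXaxis-congˡ E c≗d ((zero  , k) ∷ β) = *P-congʳ (E β) (c≗d k)
onXaxis-congˡ E c≗d ((suc l , k) ∷ β) = ≗-refl

constM-*M-invM-*M-embed : ∀ {s} q e B (E : MPS s) → B 0 ≡ 1ℚ →
  constM (q *P powP (invOne B) e) *M invM (constM B -M varX1) *M embed E
    ≈M onXaxis (λ k → q *P powP (invOne B) (e ℕ.+ suc k)) E
constM-*M-invM-*M-embed {s} q e B E B₀≡1 = begin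
  constM D *M invM H *M embed E
    ≈⟨ *M-congʳ (embed E) (constM-*M D (invM H)) ⟩
  (D ·M invM H) *M embed E
    ≈⟨ *M-congʳ (embed E) (·M-congˡ D (invM-coefficients B B₀≡1)) ⟩
  (D ·M onXaxis c oneM) *M embed E
    ≈⟨ *M-congʳ (embed E) (·M-onXaxis D c oneM) ⟩
  onXaxis (λ k → D *P c k) oneM *M embed E
    ≈⟨ onXaxis-*M-embed (λ k → D *P c k) oneM E ⟩
  onXaxis (λ k → D *P c k) (oneM *M E)
    ≈⟨ onXaxis-congʳ (λ k → D *P c k) (oneM-*M E) ⟩
  onXaxis (λ k → D *P c k) E
    ≈⟨ onXaxis-congˡ E powers ⟩
  onXaxis (λ k → q *P powP (invOne B) (e ℕ.+ suc k)) E ∎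
  where
  open ≈M-Reasoning
  open InverseOfConstMinusX1 using (invM-coefficients)
  H : MPS (suc s)
  H = constM B -M varX1
  D : PS
  D = q *P powP (invOne B) e
  c : ℕ → PS
  c k = powP (invOne B) (suc k)
  powers : ∀ k → D *P c k ≗ q *P powP (invOne B) (e ℕ.+ suc k)
  powers k = ≗-trans (*P-assoc q (powP (invOne B) e) (c k)) (*P-congˡ q (powP-+ (invOne B) e (suc k)))

-- Peeling off the smallest summation index n₁ = lo

Zsum-split : ∀ N lo e es → lo < N →
  Zsum N lo (e ∷ es) ≗ term N e lo *P Zsum N (next e lo) es +P Zsum N (suc lo) (e ∷ es)
Zsum-split (suc N) lo e es (s≤s lo≤N) j = begin
  sumLt (suc N ∸ lo) (λ i → F (lo ℕ.+ i) j)
    ≡⟨ cong (λ n → sumLt n (λ i → F (lo ℕ.+ i) j)) (ℕₚ.+-∸-assoc 1 lo≤N) ⟩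
  sumLt (suc (N ∸ lo)) (λ i → F (lo ℕ.+ i) j)
    ≡⟨ sumLt-head (N ∸ lo) (λ i → F (lo ℕ.+ i) j) ⟩
  F (lo ℕ.+ 0) j + sumLt (N ∸ lo) (λ i → F (lo ℕ.+ suc i) j)
    ≡⟨ cong₂ _+_ (cong (λ n → F n j) (ℕₚ.+-identityʳ lo))
                 (sumLt-cong (N ∸ lo) (λ i → cong (λ n → F n j) (ℕₚ.+-suc lo i))) ⟩
  F lo j + sumLt (N ∸ lo) (λ i → F (suc lo ℕ.+ i) j) ∎
  where
  open ≡-Reasoning
  F : ℕ → PS
  F n = term (suc N) e n *P Zsum (suc N) (next e n) es

sumOver : ∀ {A : Set} → List A → (A → PS) → PS
sumOver xs F = sumPSList (List.map F xs)

sumOver-cong : ∀ {A : Set} (xs : List A) {F F′ : A → PS} →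
  (∀ x → F x ≗ F′ x) → sumOver xs F ≗ sumOver xs F′
sumOver-cong []       F≗F′ = ≗-refl
sumOver-cong (x ∷ xs) F≗F′ = +P-cong (F≗F′ x) (sumOver-cong xs F≗F′)

sumOver-distrib-+P : ∀ {A : Set} (xs : List A) (F F′ : A → PS) →
  sumOver xs (λ x → F x +P F′ x) ≗ sumOver xs F +P sumOver xs F′
sumOver-distrib-+P []       F F′ j = sym (ℚₚ.+-identityˡ 0ℚ)
sumOver-distrib-+P (x ∷ xs) F F′ j =
  trans (cong ((F x j + F′ x j) +_) (sumOver-distrib-+P xs F F′ j))
        (solve 4 (λ a b c d → (a :+ b) :+ (c :+ d) := (a :+ c) :+ (b :+ d))
                 refl (F x j) (F′ x j) (sumOver xs F j) (sumOver xs F′ j))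

*P-distribˡ-sumOver : ∀ {A : Set} (xs : List A) c (F : A → PS) →
  c *P sumOver xs F ≗ sumOver xs (λ x → c *P F x)
*P-distribˡ-sumOver []       c F = *P-zeroʳ c
*P-distribˡ-sumOver (x ∷ xs) c F =
  ≗-trans (*P-distribˡ-+P c (F x) (sumOver xs F)) (+P-cong {c *P F x} ≗-refl (*P-distribˡ-sumOver xs c F))

sumPSList-++ : ∀ (fs gs : List PS) → sumPSList (fs ++ gs) ≗ sumPSList fs +P sumPSList gs
sumPSList-++ []       gs j = sym (ℚₚ.+-identityˡ (sumPSList gs j))
sumPSList-++ (f ∷ fs) gs j =
  trans (cong (f j +_) (sumPSList-++ fs gs j)) (sym (ℚₚ.+-assoc (f j) (sumPSList fs j) (sumPSList gs j)))

sumOver-concatMap : ∀ {A B : Set} (F : B → PS) (h : A → List B) (xs : List A) →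
  sumOver (concatMap h xs) F ≗ sumOver xs (λ x → sumOver (h x) F)
sumOver-concatMap F h []       = ≗-refl
sumOver-concatMap F h (x ∷ xs) = begin
  sumPSList (List.map F (h x ++ concatMap h xs))
    ≈⟨ (λ j → cong (λ l → sumPSList l j) (Listₚ.map-++ F (h x) (concatMap h xs))) ⟩
  sumPSList (List.map F (h x) ++ List.map F (concatMap h xs))
    ≈⟨ sumPSList-++ (List.map F (h x)) (List.map F (concatMap h xs)) ⟩
  sumOver (h x) F +P sumOver (concatMap h xs) F
    ≈⟨ +P-cong {sumOver (h x) F} ≗-refl (sumOver-concatMap F h xs) ⟩
  sumOver (x ∷ xs) (λ x → sumOver (h x) F) ∎
  where open ≗-Reasoning

ZsumDia : ℕ → ℕ → List ℕ → PS
ZsumDia N lo ks = sumOver (variants ks) (Zsum N lo)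

ZsumDia-split-1 : ∀ N lo ks → lo < N →
  ZsumDia N lo (1 ∷ ks) ≗
  term N bar lo *P ZsumDia N lo ks +P (term N (nat 1) lo *P ZsumDia N (suc lo) ks +P ZsumDia N (suc lo) (1 ∷ ks))
ZsumDia-split-1 N lo ks lo<N = begin
  ZsumDia N lo (1 ∷ ks)
    ≈⟨ sumOver-concatMap (Zsum N lo) _ vs ⟩
  sumOver vs (λ v → Zsum N lo (bar ∷ v) +P (Zsum N lo (nat 1 ∷ v) +P zeroP))
    ≈⟨ sumOver-cong vs split ⟩
  sumOver vs (λ v → t̄ *P Zsum N lo v +P (t₁ *P Zsum N (suc lo) v +P Z′ v))
    ≈⟨ sumOver-distrib-+P vs (λ v → t̄ *P Zsum N lo v) _ ⟩
  sumOver vs (λ v → t̄ *P Zsum N lo v) +P sumOver vs (λ v → t₁ *P Zsum N (suc lo) v +P Z′ v)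
    ≈⟨ +P-cong (≗-sym (*P-distribˡ-sumOver vs t̄ (Zsum N lo)))
               (≗-trans (sumOver-distrib-+P vs (λ v → t₁ *P Zsum N (suc lo) v) Z′)
                        (+P-cong (≗-sym (*P-distribˡ-sumOver vs t₁ (Zsum N (suc lo))))
                                 (≗-sym (sumOver-concatMap (Zsum N (suc lo)) _ vs)))) ⟩
  t̄ *P ZsumDia N lo ks +P (t₁ *P ZsumDia N (suc lo) ks +P ZsumDia N (suc lo) (1 ∷ ks))
    ∎
  where
  open ≗-Reasoning
  vs : List (List Ent)
  vs = variants ks
  t̄ t₁ : PS
  t̄ = term N bar lo
  t₁ = term N (nat 1) lo
  Z′ : List Ent → PS
  Z′ v = Zsum N (suc lo) (bar ∷ v) +P (Zsum N (suc lo) (nat 1 ∷ v) +P zeroP)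
  split : ∀ v → Zsum N lo (bar ∷ v) +P (Zsum N lo (nat 1 ∷ v) +P zeroP)
              ≗ t̄ *P Zsum N lo v +P (t₁ *P Zsum N (suc lo) v +P Z′ v)
  split v j =
    trans (cong₂ (λ x y → x + (y + 0ℚ)) (Zsum-split N lo bar v lo<N j) (Zsum-split N lo (nat 1) v lo<N j))
          (solve 5 (λ a b c d z → (a :+ b) :+ ((c :+ d) :+ z) := a :+ (c :+ (b :+ (d :+ z)))) refl
                 ((t̄ *P Zsum N lo v) j) (Zsum N (suc lo) (bar ∷ v) j)
                 ((t₁ *P Zsum N (suc lo) v) j) (Zsum N (suc lo) (nat 1 ∷ v) j) 0ℚ)

ZsumDia-split-≥2 : ∀ N lo k ks → lo < N →
  ZsumDia N lo (suc (suc k) ∷ ks) ≗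
  term N (nat (suc (suc k))) lo *P ZsumDia N (suc lo) ks +P ZsumDia N (suc lo) (suc (suc k) ∷ ks)
ZsumDia-split-≥2 N lo k ks lo<N = begin
  ZsumDia N lo (suc (suc k) ∷ ks)
    ≈⟨ sumOver-concatMap (Zsum N lo) _ vs ⟩
  sumOver vs (λ v → Zsum N lo (e ∷ v) +P zeroP)
    ≈⟨ sumOver-cong vs split ⟩
  sumOver vs (λ v → t *P Zsum N (suc lo) v +P (Zsum N (suc lo) (e ∷ v) +P zeroP))
    ≈⟨ sumOver-distrib-+P vs (λ v → t *P Zsum N (suc lo) v) _ ⟩
  sumOver vs (λ v → t *P Zsum N (suc lo) v) +P sumOver vs (λ v → Zsum N (suc lo) (e ∷ v) +P zeroP)
    ≈⟨ +P-cong (≗-sym (*P-distribˡ-sumOver vs t (Zsum N (suc lo))))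
               (≗-sym (sumOver-concatMap (Zsum N (suc lo)) _ vs)) ⟩
  t *P ZsumDia N (suc lo) ks +P ZsumDia N (suc lo) (suc (suc k) ∷ ks)
    ∎
  where
  open ≗-Reasoning
  vs : List (List Ent)
  vs = variants ks
  e : Ent
  e = nat (suc (suc k))
  t : PS
  t = term N e lo
  split : ∀ v → Zsum N lo (e ∷ v) +P zeroP ≗ t *P Zsum N (suc lo) v +P (Zsum N (suc lo) (e ∷ v) +P zeroP)
  split v j = trans (cong (_+ 0ℚ) (Zsum-split N lo e v lo<N j))
                    (ℚₚ.+-assoc ((t *P Zsum N (suc lo) v) j) (Zsum N (suc lo) (e ∷ v) j) 0ℚ)

-- The holes are the pattern lambdas inside xi0 and xi1, which can only be referred to by unification.
G⁰-split-bar : ∀ {s} m N l k (β : Idx s) → suc m < N →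
  G Fin.zero m N ((suc l , k) ∷ β) ≗
  invOne (bracket (N ∸ suc m)) *P G Fin.zero m N ((l , k) ∷ β) +P G Fin.zero (suc m) N ((suc l , k) ∷ β)
G⁰-split-bar m N l k β m<N =
  Zsum-split N (suc m) bar ((List.replicate l bar ++ nat (suc k) ∷ []) ++ concatMap _ (Vec.toList (Vec.map _ β))) m<N

G⁰-split-nat : ∀ {s} m N k (β : Idx s) → suc m < N →
  G Fin.zero m N ((0 , k) ∷ β) ≗
  term N (nat (suc k)) (suc m) *P G Fin.zero (suc m) N β +P G Fin.zero (suc m) N ((0 , k) ∷ β)
G⁰-split-nat m N k β m<N = Zsum-split N (suc m) (nat (suc k)) (concatMap _ (Vec.toList (Vec.map _ β))) m<N

G¹-split-1 : ∀ {s} m N l k (β : Idx s) → suc m < N →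
  G (# 1) m N ((suc l , k) ∷ β) ≗
  invOne (bracket (N ∸ suc m)) *P G (# 1) m N ((l , k) ∷ β)
    +P (term N (nat 1) (suc m) *P G (# 1) (suc m) N ((l , k) ∷ β) +P G (# 1) (suc m) N ((suc l , k) ∷ β))
G¹-split-1 m N l k β m<N =
  ZsumDia-split-1 N (suc m) ((List.replicate l 1 ++ suc (suc k) ∷ []) ++ concatMap _ (Vec.toList (Vec.map _ β))) m<N

G¹-split-≥2 : ∀ {s} m N k (β : Idx s) → suc m < N →
  G (# 1) m N ((0 , k) ∷ β) ≗
  term N (nat (suc (suc k))) (suc m) *P G (# 1) (suc m) N β +P G (# 1) (suc m) N ((0 , k) ∷ β)
G¹-split-≥2 m N k β m<N = ZsumDia-split-≥2 N (suc m) k (concatMap _ (Vec.toList (Vec.map _ β))) m<N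

G⁰-recursion : ∀ {s} m N → suc m < N →
  G {suc s} Fin.zero m N -M shiftY1 (invOne (bracket (N ∸ suc m)) ·M G Fin.zero m N)
    ≈M G Fin.zero (suc m) N +M onXaxis (λ k → term N (nat (suc k)) (suc m)) (G {s} Fin.zero (suc m) N)
G⁰-recursion m N m<N ((suc l , k) ∷ β) j = begin
  G⁰ m ((suc l , k) ∷ β) j - x    ≡⟨ cong (_- x) (G⁰-split-bar m N l k β m<N j) ⟩
  (x + y) - x                     ≡⟨ solve 2 (λ x y → (x :+ y) :- x := y :+ con 0ℚ) refl x y ⟩
  y + 0ℚ                          ∎
  where
  open ≡-Reasoning
  G⁰ : ∀ {r} → ℕ → MPS r
  G⁰ m = G Fin.zero m N
  x y : ℚ
  x = (invOne (bracket (N ∸ suc m)) *P G⁰ m ((l , k) ∷ β)) j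
  y = G⁰ (suc m) ((suc l , k) ∷ β) j
G⁰-recursion m N m<N ((zero , k) ∷ β) j = begin
  G⁰ m ((0 , k) ∷ β) j - 0ℚ      ≡⟨ cong (_- 0ℚ) (G⁰-split-nat m N k β m<N j) ⟩
  (x + y) - 0ℚ                    ≡⟨ solve 2 (λ x y → (x :+ y) :- con 0ℚ := y :+ x) refl x y ⟩
  y + x                           ∎
  where
  open ≡-Reasoning
  G⁰ : ∀ {r} → ℕ → MPS r
  G⁰ m = G Fin.zero m N
  x y : ℚ
  x = (term N (nat (suc k)) (suc m) *P G⁰ (suc m) β) j
  y = G⁰ (suc m) ((0 , k) ∷ β) j

G¹-recursion : ∀ {s} m N → suc m < N →
  G {suc s} (# 1) m N -M shiftY1 (invOne (bracket (N ∸ suc m)) ·M G (# 1) m N)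
    ≈M (G (# 1) (suc m) N +M shiftY1 ((qpow (suc m) *P invOne (bracket (suc m))) ·M G (# 1) (suc m) N))
       +M onXaxis (λ k → term N (nat (suc (suc k))) (suc m)) (G {s} (# 1) (suc m) N)
G¹-recursion m N m<N ((suc l , k) ∷ β) j = begin
  G¹ m ((suc l , k) ∷ β) j - x
    ≡⟨ cong (_- x) (G¹-split-1 m N l k β m<N j) ⟩
  (x + (y + z)) - x
    ≡⟨ solve 3 (λ x y z → (x :+ (y :+ z)) :- x := (z :+ y) :+ con 0ℚ) refl x y z ⟩
  (z + y) + 0ℚ
    ≡⟨ cong (λ y → (z + y) + 0ℚ) (*P-congʳ (G¹ (suc m) ((l , k) ∷ β)) q⟨M⟩⁻¹ j) ⟩
  (z + ((qpow (suc m) *P invOne (bracket (suc m))) *P G¹ (suc m) ((l , k) ∷ β)) j) + 0ℚ ∎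
  where
  open ≡-Reasoning
  G¹ : ∀ {r} → ℕ → MPS r
  G¹ m = G (# 1) m N
  x y z : ℚ
  x = (invOne (bracket (N ∸ suc m)) *P G¹ m ((l , k) ∷ β)) j
  y = (term N (nat 1) (suc m) *P G¹ (suc m) ((l , k) ∷ β)) j
  z = G¹ (suc m) ((suc l , k) ∷ β) j
  q⟨M⟩⁻¹ : term N (nat 1) (suc m) ≗ qpow (suc m) *P invOne (bracket (suc m))
  q⟨M⟩⁻¹ = *P-congˡ (qpow (suc m)) (*P-identityˡ (invOne (bracket (suc m))))
G¹-recursion m N m<N ((zero , k) ∷ β) j = begin
  G¹ m ((0 , k) ∷ β) j - 0ℚ      ≡⟨ cong (_- 0ℚ) (G¹-split-≥2 m N k β m<N j) ⟩
  (x + y) - 0ℚ                    ≡⟨ solve 2 (λ x y → (x :+ y) :- con 0ℚ := (y :+ con 0ℚ) :+ x) refl x y ⟩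
  (y + 0ℚ) + x                    ∎
  where
  open ≡-Reasoning
  G¹ : ∀ {r} → ℕ → MPS r
  G¹ m = G (# 1) m N
  x y : ℚ
  x = (term N (nat (suc (suc k))) (suc m) *P G¹ (suc m) β) j
  y = G¹ (suc m) ((0 , k) ∷ β) j

⟨N-M⟩-Y₁-cancel : ∀ {s} m N (F : MPS (suc s)) → suc m < N →
  (constM (bracket (N ∸ suc m)) -M varY1) *M constM (invOne (bracket (N ∸ suc m))) *M F
    ≈M F -M shiftY1 (invOne (bracket (N ∸ suc m)) ·M F)
⟨N-M⟩-Y₁-cancel m N F m<N =
  [⟨A⟩-Y₁]⟨A⟩⁻¹-*M (bracket (N ∸ suc m)) (invOne (bracket (N ∸ suc m))) F
                   (bracket-*P-inverse (N ∸ suc m) (ℕₚ.m<n⇒0<n∸m m<N))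

lemma3p3 : (ε : Fin 2) (M N : ℕ) → 0 < M → M < N → (s : ℕ) →
    (constM (bracket (N ∸ M)) -M varY1) *M constM (invOne (bracket (N ∸ M))) *M G {suc s} ε (M ∸ 1) N
      ≈M
    powM (oneM +M constM (qpow M *P invOne (bracket M)) *M varY1) (toℕ ε) *M G ε M N
      +M constM (qpow M *P powP (invOne (bracket M)) (toℕ ε)) *M invM (constM (bracket M) -M varX1) *M embed (G {s} ε M N)
lemma3p3 Fin.zero (suc m) N _ m<N s =
  ≈M-trans (⟨N-M⟩-Y₁-cancel m N (G Fin.zero m N) m<N)
  (≈M-trans (G⁰-recursion m N m<N)
  (≈M-sym (+M-cong (oneM-*M (G Fin.zero (suc m) N))
                   (constM-*M-invM-*M-embed (qpow (suc m)) 0 (bracket (suc m)) (G Fin.zero (suc m) N) refl))))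
lemma3p3 (Fin.suc Fin.zero) (suc m) N _ m<N s =
  ≈M-trans (⟨N-M⟩-Y₁-cancel m N (G (# 1) m N) m<N)
  (≈M-trans (G¹-recursion m N m<N)
  (≈M-sym (+M-cong ([1+cY₁]-*M (qpow (suc m) *P invOne (bracket (suc m))) (G (# 1) (suc m) N))
                   (constM-*M-invM-*M-embed (qpow (suc m)) 1 (bracket (suc m)) (G (# 1) (suc m) N) refl))))
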